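{- Let $c(n)$, for integers $n\geq -1$, be defined by the $q$-expansion $$\frac{\eta^{24}(\tau)}{\eta^{24}(2\tau)}=\frac{1}{q}\prod_{m=1}^{\infty}\frac{(1-q^{m})^{24}}{(1-q^{2m})^{24}}=\sum_{n=-1}^{\infty}c(n)q^{n},$$ where $q=e^{2\pi i\tau}$, $\tau$ in the upper half-plane. Then for every integer $n\geq -1$ we have $(-1)^{n+1}c(n)>0$; that is, $c(n)>0$ if $n$ is odd and $c(n)<0$ if $n$ is even.
   Context: $\eta(\tau)=q^{1/24}\prod_{m=1}^{\infty}(1-q^{m})$ is the Dedekind eta function, with $q=e^{2\pi i\tau}$ and $\operatorname{Im}\tau>0$. -}

module Defs where

open import Data.Nat as ℕ using (ℕ; zero; suc; _∸_)
open import Data.Nat.Divisibility using (_∣?_)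
open import Data.Integer as ℤ using (ℤ; +_; -[1+_]; ∣_∣)
open import Data.List using (List; map; foldr; upTo)
open import Data.Bool using (if_then_else_)
open import Relation.Nullary using (does)

-- Formal power series in q with integer coefficients: k ↦ coefficient of q^k.
Series : Set
Series = ℕ → ℤ

one : Series
one zero    = + 1
one (suc _) = + 0

_⊛_ : Series → Series → Series
(f ⊛ g) k = foldr ℤ._+_ (+ 0) (map (λ i → f i ℤ.* g (k ∸ i)) (upTo (suc k)))

_^ˢ_ : Series → ℕ → Series
f ^ˢ zero  = one
f ^ˢ suc e = f ⊛ (f ^ˢ e)

-- The polynomial 1 - q^m, for m ≥ 1 (only used with m ≥ 1).
oneMinusQ^ : ℕ → Series
oneMinusQ^ m zero = + 1
oneMinusQ^ m (suc k) = if does (suc k ℕ.≟ m) then -[1+ 0 ] else + 0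

-- The series 1/(1 - q^d) = Σ_{j≥0} q^{dj}, for d ≥ 1 (only used with d ≥ 1).
invOneMinusQ^ : ℕ → Series
invOneMinusQ^ d k = if does (d ∣? k) then + 1 else + 0

factor : ℕ → Series
factor m = (oneMinusQ^ m ^ˢ 24) ⊛ (invOneMinusQ^ (2 ℕ.* m) ^ˢ 24)

partialProd : ℕ → Series
partialProd zero    = one
partialProd (suc N) = partialProd N ⊛ factor (suc N)

-- Coefficient of q^k in the infinite product ∏_{m≥1} factor m.
-- Since factor m ≡ 1 mod q^m, factors with m > k do not affect the
-- coefficient of q^k, so it equals the coefficient in the partial product
-- up to m = k.
prodCoeff : ℕ → ℤ
prodCoeff k = partialProd k k

-- c(n) for integers n ≥ -1: η^24(τ)/η^24(2τ) = q^{-1} ∏ … = Σ_{n≥-1} c(n) q^n,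
-- so c(n) is the coefficient of q^{n+1} in the product.
-- (Only meaningful for n ≥ -1.)
c : ℤ → ℤ
c n = prodCoeff ∣ n ℤ.+ + 1 ∣

-- Let P_N = ∏_{m=1}^{N} (1-q^m)^e (1-q^{2m})^{-e}; then c(n) is the coefficient of
-- q^{n+1} in P_{n+1} (with e = 24).  The sign twist σ : q ↦ -q, i.e.
-- σ(f)_k = (-1)^k f_k, is multiplicative, so the claim is that σ(P_N) has a
-- positive coefficient of q^N.  Now σ fixes 1-q^m for m even and (1-q^{2m})^{-1}
-- for every m, and sends 1-q^m to 1+q^m for m odd.  Sorting the factors, for
-- N = 2K or N = 2K+1,
--     σ(P_N) = Odd · Even_K · Inv_N,   Odd = ∏_{m ≤ N odd} (1+q^m)^e,
--     Even_K = ∏_{j ≤ K} (1-q^{2j})^e,  Inv_N = ∏_{m ≤ N} (1-q^{2m})^{-e}.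
-- Since Even_K · Inv_K = 1 and the factors of Inv_N with m > K are ≡ 1 modulo
-- q^{2K+2}, σ(P_N) ≡ Odd modulo q^{N+1}.  Finally Odd has non-negative
-- coefficients and a positive coefficient of q^N: take q^N itself for N odd and
-- q · q^{N-1} for N even (for N = 2 this uses the q² term of (1+q)^e, e ≥ 2).
module Submission where

open import Defs
open import Data.Integer using (ℤ; +_; -[1+_]; _+_; _*_; -_; _^_; _≤_; _<_; ∣_∣; +≤+; +<+)
import Data.Integer.Properties as ℤP
open import Data.Integer.Tactic.RingSolver using (solve-∀)
open import Data.Nat as ℕ using (ℕ; zero; suc; _∸_; z≤n; s≤s)
import Data.Nat.Properties as ℕP
open import Data.Nat.Divisibility
  using (_∣_; divides; _∣?_; _∣0; ∣-refl; ∣-trans; ∣⇒≤; m∣m*n; ∣m∣n⇒∣m+n; ∣m+n∣m⇒∣n)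
open import Data.List using (map; foldr; applyUpTo)
open import Data.Product using (_,_)
open import Data.Vec using ([]; _∷_)
open import Data.Fin using (#_)
open import Function using (id)
open import Relation.Nullary using (¬_; yes; no; does)
open import Data.Bool using (true; false; if_then_else_)
open import Relation.Nullary.Decidable using (dec-true; dec-false)
open import Relation.Binary using (IsEquivalence)
open import Relation.Binary.PropositionalEquality hiding (setoid)
open import Algebra.Bundles using (CommutativeMonoid)
import Relation.Binary.Reasoning.Setoid as SetoidReasoning

sumTo : ℕ → (ℕ → ℤ) → ℤ
sumTo zero    f = + 0
sumTo (suc n) f = f 0 + sumTo n (λ i → f (suc i))

foldr-applyUpTo : ∀ n (g : ℕ → ℕ) (h : ℕ → ℤ) →
  foldr _+_ (+ 0) (map h (applyUpTo g n)) ≡ sumTo n (λ i → h (g i))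
foldr-applyUpTo zero    g h = refl
foldr-applyUpTo (suc n) g h = cong (_+_ (h (g 0))) (foldr-applyUpTo n (λ i → g (suc i)) h)

sumTo-cong : ∀ n {f g : ℕ → ℤ} → (∀ i → i ℕ.< n → f i ≡ g i) → sumTo n f ≡ sumTo n g
sumTo-cong zero    eq = refl
sumTo-cong (suc n) eq = cong₂ _+_ (eq 0 (s≤s z≤n)) (sumTo-cong n (λ i i<n → eq (suc i) (s≤s i<n)))

sumTo-zero : ∀ n {f : ℕ → ℤ} → (∀ i → i ℕ.< n → f i ≡ + 0) → sumTo n f ≡ + 0
sumTo-zero zero    eq = refl
sumTo-zero (suc n) eq =
  cong₂ _+_ (eq 0 (s≤s z≤n)) (sumTo-zero n (λ i i<n → eq (suc i) (s≤s i<n)))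

sumTo-single : ∀ n j {f : ℕ → ℤ} → j ℕ.< n →
  (∀ i → i ℕ.< n → i ≢ j → f i ≡ + 0) → sumTo n f ≡ f j
sumTo-single (suc n) zero {f} _ eq =
  trans (cong (_+_ (f 0)) (sumTo-zero n (λ i i<n → eq (suc i) (s≤s i<n) (λ ())))) (ℤP.+-identityʳ (f 0))
sumTo-single (suc n) (suc j) {f} (s≤s j<n) eq =
  trans (cong (_+ sumTo n (λ i → f (suc i))) (eq 0 (s≤s z≤n) (λ ())))
    (trans (ℤP.+-identityˡ (sumTo n (λ i → f (suc i))))
      (sumTo-single n j j<n (λ i i<n i≢j →
        eq (suc i) (s≤s i<n) (λ si≡sj → i≢j (ℕP.suc-injective si≡sj)))))

sumTo-+ : ∀ n (f g : ℕ → ℤ) → sumTo n (λ i → f i + g i) ≡ sumTo n f + sumTo n g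
sumTo-+ zero    f g = refl
sumTo-+ (suc n) f g =
  trans (cong (_+_ (f 0 + g 0)) (sumTo-+ n _ _)) (middle-swap (f 0) (g 0) _ _)
  where
  middle-swap : ∀ a b x y → a + b + (x + y) ≡ a + x + (b + y)
  middle-swap = solve-∀

sumTo-*ˡ : ∀ n a (f : ℕ → ℤ) → a * sumTo n f ≡ sumTo n (λ i → a * f i)
sumTo-*ˡ zero    a f = ℤP.*-zeroʳ a
sumTo-*ˡ (suc n) a f = trans (ℤP.*-distribˡ-+ a (f 0) _) (cong (_+_ (a * f 0)) (sumTo-*ˡ n a _))

sumTo-*ʳ : ∀ n a (f : ℕ → ℤ) → sumTo n f * a ≡ sumTo n (λ i → f i * a)
sumTo-*ʳ n a f =
  trans (ℤP.*-comm _ a) (trans (sumTo-*ˡ n a f) (sumTo-cong n (λ i _ → ℤP.*-comm a (f i))))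

sumTo-last : ∀ n (f : ℕ → ℤ) → sumTo (suc n) f ≡ sumTo n f + f n
sumTo-last zero    f = trans (ℤP.+-identityʳ (f 0)) (sym (ℤP.+-identityˡ (f 0)))
sumTo-last (suc n) f = trans (cong (_+_ (f 0)) (sumTo-last n _)) (sym (ℤP.+-assoc (f 0) _ _))

sumTo-reverse : ∀ n (f : ℕ → ℤ) → sumTo n f ≡ sumTo n (λ i → f (n ∸ suc i))
sumTo-reverse zero    f = refl
sumTo-reverse (suc n) f = begin
    f 0 + sumTo n (λ i → f (suc i))
  ≡⟨ cong (_+_ (f 0)) (sumTo-reverse n _) ⟩
    f 0 + sumTo n (λ i → f (suc (n ∸ suc i)))
  ≡⟨ ℤP.+-comm (f 0) _ ⟩
    sumTo n (λ i → f (suc (n ∸ suc i))) + f 0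
  ≡⟨ cong₂ _+_ (sumTo-cong n (λ i i<n → cong f (sym (ℕP.+-∸-assoc 1 i<n))))
               (cong f (sym (ℕP.n∸n≡0 n))) ⟩
    sumTo n (λ i → f (n ∸ i)) + f (n ∸ n)
  ≡⟨ sumTo-last n (λ i → f (n ∸ i)) ⟨
    sumTo (suc n) (λ i → f (n ∸ i))
  ∎
  where open ≡-Reasoning

-- Summing over the triangle {(i, j) | i + j ≤ k} by rows or by diagonals;
-- this gives associativity of the product.
sumTo-triangle : ∀ k (G : ℕ → ℕ → ℤ) →
  sumTo (suc k) (λ i → sumTo (suc (k ∸ i)) (G i)) ≡
  sumTo (suc k) (λ l → sumTo (suc l) (λ i → G i (l ∸ i)))
sumTo-triangle zero    G = refl
sumTo-triangle (suc k) G = begin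
    sumTo (suc (suc k)) (G 0) + sumTo (suc k) (λ i → sumTo (suc (k ∸ i)) (G (suc i)))
  ≡⟨ cong (_+_ (sumTo (suc (suc k)) (G 0))) (sumTo-triangle k (λ i → G (suc i))) ⟩
    sumTo (suc (suc k)) (G 0) + sumTo (suc k) (λ l → sumTo (suc l) (λ i → G (suc i) (l ∸ i)))
  ≡⟨ cong (_+_ (sumTo (suc (suc k)) (G 0))) (sym (ℤP.+-identityˡ _)) ⟩
    sumTo (suc (suc k)) (G 0) + sumTo (suc (suc k)) diagonalTail
  ≡⟨ sumTo-+ (suc (suc k)) (G 0) diagonalTail ⟨
    sumTo (suc (suc k)) (λ l → G 0 l + diagonalTail l)
  ∎
  where
  open ≡-Reasoning
  diagonalTail : ℕ → ℤ
  diagonalTail l = sumTo l (λ i → G (suc i) (l ∸ suc i))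

⊛-coeff : ∀ f g k → (f ⊛ g) k ≡ sumTo (suc k) (λ i → f i * g (k ∸ i))
⊛-coeff f g k = foldr-applyUpTo (suc k) id (λ i → f i * g (k ∸ i))

≗-isEquivalence : IsEquivalence (_≗_ {A = ℕ} {B = ℤ})
≗-isEquivalence = record
  { refl  = λ _ → refl
  ; sym   = λ f≗g k → sym (f≗g k)
  ; trans = λ f≗g g≗h k → trans (f≗g k) (g≗h k)
  }

open IsEquivalence ≗-isEquivalence using ()
  renaming (refl to ≗-refl; sym to ≗-sym; trans to ≗-trans)

⊛-cong : ∀ {f f′ g g′} → f ≗ f′ → g ≗ g′ → f ⊛ g ≗ f′ ⊛ g′
⊛-cong {f} {f′} {g} {g′} f≗f′ g≗g′ k =
  trans (⊛-coeff f g k)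
    (trans (sumTo-cong (suc k) (λ i _ → cong₂ _*_ (f≗f′ i) (g≗g′ (k ∸ i))))
      (sym (⊛-coeff f′ g′ k)))

⊛-congˡ : ∀ f {g g′} → g ≗ g′ → f ⊛ g ≗ f ⊛ g′
⊛-congˡ f {g} {g′} = ⊛-cong {f} {f} {g} {g′} (λ _ → refl)

⊛-congʳ : ∀ {f f′} g → f ≗ f′ → f ⊛ g ≗ f′ ⊛ g
⊛-congʳ {f} {f′} g f≗f′ = ⊛-cong {f} {f′} {g} {g} f≗f′ (λ _ → refl)

⊛-comm : ∀ f g → f ⊛ g ≗ g ⊛ f
⊛-comm f g k = begin
    (f ⊛ g) k
  ≡⟨ ⊛-coeff f g k ⟩
    sumTo (suc k) (λ i → f i * g (k ∸ i))
  ≡⟨ sumTo-reverse (suc k) (λ i → f i * g (k ∸ i)) ⟩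
    sumTo (suc k) (λ i → f (k ∸ i) * g (k ∸ (k ∸ i)))
  ≡⟨ sumTo-cong (suc k) (λ i i≤k →
       trans (ℤP.*-comm (f (k ∸ i)) (g (k ∸ (k ∸ i))))
             (cong (λ j → g j * f (k ∸ i)) (ℕP.m∸[m∸n]≡n (ℕP.≤-pred i≤k)))) ⟩
    sumTo (suc k) (λ i → g i * f (k ∸ i))
  ≡⟨ ⊛-coeff g f k ⟨
    (g ⊛ f) k
  ∎
  where open ≡-Reasoning

⊛-assoc : ∀ f g h → (f ⊛ g) ⊛ h ≗ f ⊛ (g ⊛ h)
⊛-assoc f g h k = begin
    ((f ⊛ g) ⊛ h) k
  ≡⟨ ⊛-coeff (f ⊛ g) h k ⟩
    sumTo (suc k) (λ l → (f ⊛ g) l * h (k ∸ l))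
  ≡⟨ sumTo-cong (suc k) (λ l l≤k → diagonal l (ℕP.≤-pred l≤k)) ⟩
    sumTo (suc k) (λ l → sumTo (suc l) (λ i → G i (l ∸ i)))
  ≡⟨ sumTo-triangle k G ⟨
    sumTo (suc k) (λ i → sumTo (suc (k ∸ i)) (G i))
  ≡⟨ sumTo-cong (suc k) (λ i _ → row i) ⟩
    sumTo (suc k) (λ i → f i * (g ⊛ h) (k ∸ i))
  ≡⟨ ⊛-coeff f (g ⊛ h) k ⟨
    (f ⊛ (g ⊛ h)) k
  ∎
  where
  open ≡-Reasoning
  G : ℕ → ℕ → ℤ
  G i j = f i * (g j * h (k ∸ i ∸ j))

  diagonal : ∀ l → l ℕ.≤ k → (f ⊛ g) l * h (k ∸ l) ≡ sumTo (suc l) (λ i → G i (l ∸ i))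
  diagonal l l≤k =
    trans (cong (_* h (k ∸ l)) (⊛-coeff f g l))
      (trans (sumTo-*ʳ (suc l) (h (k ∸ l)) (λ i → f i * g (l ∸ i)))
        (sumTo-cong (suc l) (λ i i≤l →
          trans (ℤP.*-assoc (f i) (g (l ∸ i)) _)
            (cong (λ m → f i * (g (l ∸ i) * h m))
              (sym (trans (ℕP.∸-+-assoc k i (l ∸ i))
                          (cong (k ∸_) (ℕP.m+[n∸m]≡n (ℕP.≤-pred i≤l)))))))))

  row : ∀ i → sumTo (suc (k ∸ i)) (G i) ≡ f i * (g ⊛ h) (k ∸ i)
  row i = sym (trans (cong (f i *_) (⊛-coeff g h (k ∸ i)))
                     (sumTo-*ˡ (suc (k ∸ i)) (f i) (λ j → g j * h (k ∸ i ∸ j))))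

⊛-identityˡ : ∀ f → one ⊛ f ≗ f
⊛-identityˡ f k =
  trans (⊛-coeff one f k)
    (trans (cong₂ _+_ (ℤP.*-identityˡ (f k)) (sumTo-zero k (λ i _ → ℤP.*-zeroˡ (f (k ∸ suc i)))))
      (ℤP.+-identityʳ (f k)))

⊛-identityʳ : ∀ f → f ⊛ one ≗ f
⊛-identityʳ f = ≗-trans (⊛-comm f one) (⊛-identityˡ f)

⊛-commutativeMonoid : CommutativeMonoid _ _
⊛-commutativeMonoid = record
  { Carrier = Series
  ; _≈_ = _≗_
  ; _∙_ = _⊛_
  ; ε = one
  ; isCommutativeMonoid = record
    { isMonoid = record
      { isSemigroup = record
        { isMagma = record { isEquivalence = ≗-isEquivalence ; ∙-cong = ⊛-cong }
        ; assoc = ⊛-assoc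
        }
      ; identity = ⊛-identityˡ , ⊛-identityʳ
      }
    ; comm = ⊛-comm
    }
  }

open import Algebra.Properties.CommutativeSemigroup
  (CommutativeMonoid.commutativeSemigroup ⊛-commutativeMonoid) using (interchange)
open import Algebra.Solver.CommutativeMonoid ⊛-commutativeMonoid using (prove; var; _⊕_)
module ≗-Reasoning = SetoidReasoning (CommutativeMonoid.setoid ⊛-commutativeMonoid)

regroup-odd : ∀ a b c d f → ((a ⊛ b) ⊛ c) ⊛ (d ⊛ f) ≗ ((a ⊛ d) ⊛ b) ⊛ (c ⊛ f)
regroup-odd a b c d f =
  prove 5 (((A ⊕ B) ⊕ C) ⊕ (D ⊕ F)) (((A ⊕ D) ⊕ B) ⊕ (C ⊕ F)) (a ∷ b ∷ c ∷ d ∷ f ∷ [])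
  where A = var (# 0); B = var (# 1); C = var (# 2); D = var (# 3); F = var (# 4)

regroup-even : ∀ a b c d f → ((a ⊛ b) ⊛ c) ⊛ (d ⊛ f) ≗ (a ⊛ (b ⊛ d)) ⊛ (c ⊛ f)
regroup-even a b c d f =
  prove 5 (((A ⊕ B) ⊕ C) ⊕ (D ⊕ F)) ((A ⊕ (B ⊕ D)) ⊕ (C ⊕ F)) (a ∷ b ∷ c ∷ d ∷ f ∷ [])
  where A = var (# 0); B = var (# 1); C = var (# 2); D = var (# 3); F = var (# 4)

pow-cong : ∀ {f g} e → f ≗ g → f ^ˢ e ≗ g ^ˢ e
pow-cong zero    f≗g = ≗-refl
pow-cong (suc e) f≗g = ⊛-cong f≗g (pow-cong e f≗g)

pow-one : ∀ e → one ^ˢ e ≗ one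
pow-one zero    = ≗-refl
pow-one (suc e) = ≗-trans (⊛-congˡ one (pow-one e)) (⊛-identityˡ one)

pow-⊛ : ∀ f g e → (f ⊛ g) ^ˢ e ≗ (f ^ˢ e) ⊛ (g ^ˢ e)
pow-⊛ f g zero    = ≗-sym (⊛-identityˡ one)
pow-⊛ f g (suc e) = ≗-trans (⊛-congˡ (f ⊛ g) (pow-⊛ f g e)) (interchange f g (f ^ˢ e) (g ^ˢ e))

-- Equality modulo q^{N+1}

infix 4 _≈[_]_
_≈[_]_ : Series → ℕ → Series → Set
f ≈[ N ] g = ∀ k → k ℕ.≤ N → f k ≡ g k

≗⇒≈ : ∀ {f g} N → f ≗ g → f ≈[ N ] g
≗⇒≈ N f≗g k _ = f≗g k

≈-trans : ∀ {f g h} N → f ≈[ N ] g → g ≈[ N ] h → f ≈[ N ] h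
≈-trans N f≈g g≈h k k≤N = trans (f≈g k k≤N) (g≈h k k≤N)

⊛-congT : ∀ {f f′ g g′} N → f ≈[ N ] f′ → g ≈[ N ] g′ → f ⊛ g ≈[ N ] f′ ⊛ g′
⊛-congT {f} {f′} {g} {g′} N f≈f′ g≈g′ k k≤N =
  trans (⊛-coeff f g k)
    (trans (sumTo-cong (suc k) (λ i i≤k →
              cong₂ _*_ (f≈f′ i (ℕP.≤-trans (ℕP.≤-pred i≤k) k≤N))
                        (g≈g′ (k ∸ i) (ℕP.≤-trans (ℕP.m∸n≤m k i) k≤N))))
      (sym (⊛-coeff f′ g′ k)))

pow-congT : ∀ {f g} N e → f ≈[ N ] g → f ^ˢ e ≈[ N ] g ^ˢ e
pow-congT N zero    f≈g k _ = refl
pow-congT N (suc e) f≈g = ⊛-congT N f≈g (pow-congT N e f≈g)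

coeff-mod-unit : ∀ {f B R} N → f ≗ B ⊛ R → R ≈[ N ] one → f N ≡ B N
coeff-mod-unit {B = B} N f≗BR R≈1 =
  trans (f≗BR N) (trans (⊛-congT {B} {B} N (λ _ _ → refl) R≈1 N ℕP.≤-refl) (⊛-identityʳ B N))

-- The binomials 1 + a q^d and the geometric series 1/(1 - q^d)

-- lin a d = 1 + a q^d  (for d ≥ 1).
lin : ℤ → ℕ → Series
lin a d zero    = + 1
lin a d (suc k) = if does (suc k ℕ.≟ d) then a else + 0

lin-on : ∀ a d → lin a (suc d) (suc d) ≡ a
lin-on a d = cong (λ b → if b then a else + 0) (dec-true (suc d ℕ.≟ suc d) refl)

lin-off : ∀ a {d i} → suc i ≢ d → lin a d (suc i) ≡ + 0
lin-off a {d} {i} si≢d = cong (λ b → if b then a else + 0) (dec-false (suc i ℕ.≟ d) si≢d)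

oneMinusQ^≗lin : ∀ d → oneMinusQ^ d ≗ lin -[1+ 0 ] d
oneMinusQ^≗lin d zero    = refl
oneMinusQ^≗lin d (suc k) = refl

lin-⊛-below : ∀ a d f k → k ℕ.< d → (lin a d ⊛ f) k ≡ f k
lin-⊛-below a d f k k<d =
  trans (⊛-coeff (lin a d) f k)
    (trans (cong₂ _+_ (ℤP.*-identityˡ (f k))
             (sumTo-zero k (λ i i<k →
               trans (cong (_* f (k ∸ suc i)) (lin-off a (ℕP.<⇒≢ (ℕP.≤-<-trans i<k k<d))))
                     (ℤP.*-zeroˡ (f (k ∸ suc i))))))
      (ℤP.+-identityʳ (f k)))

lin-⊛-above : ∀ a d f j → (lin a (suc d) ⊛ f) (suc d ℕ.+ j) ≡ f (suc d ℕ.+ j) + a * f j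
lin-⊛-above a d f j =
  trans (⊛-coeff (lin a (suc d)) f k)
    (cong₂ _+_ (ℤP.*-identityˡ (f k))
      (trans (sumTo-single k d (s≤s (ℕP.m≤m+n d j)) (λ i _ i≢d →
                trans (cong (_* f (k ∸ suc i)) (lin-off a (λ si≡sd → i≢d (ℕP.suc-injective si≡sd))))
                      (ℤP.*-zeroˡ (f (k ∸ suc i)))))
        (cong₂ _*_ (lin-on a d) (cong f (ℕP.m+n∸m≡n (suc d) j)))))
  where
  k = suc d ℕ.+ j

inv-on : ∀ {d k} → d ∣ k → invOneMinusQ^ d k ≡ + 1
inv-on {d} {k} d∣k = cong (λ b → if b then + 1 else + 0) (dec-true (d ∣? k) d∣k)

inv-off : ∀ {d k} → ¬ d ∣ k → invOneMinusQ^ d k ≡ + 0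
inv-off {d} {k} d∤k = cong (λ b → if b then + 1 else + 0) (dec-false (d ∣? k) d∤k)

inv-shift : ∀ d j → invOneMinusQ^ d (d ℕ.+ j) ≡ invOneMinusQ^ d j
inv-shift d j with d ∣? j
... | yes d∣j = inv-on (∣m∣n⇒∣m+n ∣-refl d∣j)
... | no  d∤j = inv-off (λ d∣d+j → d∤j (∣m+n∣m⇒∣n d∣d+j ∣-refl))

inv-below : ∀ d k → suc k ℕ.< d → invOneMinusQ^ d (suc k) ≡ + 0
inv-below d k sk<d = inv-off (λ d∣sk → ℕP.<⇒≱ sk<d (∣⇒≤ d∣sk))

oneMinusQ^-inverse : ∀ d → oneMinusQ^ (suc d) ⊛ invOneMinusQ^ (suc d) ≗ one
oneMinusQ^-inverse d k with k ℕ.<? suc d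
... | yes k<d = trans (⊛-congʳ inv (oneMinusQ^≗lin (suc d)) k)
                  (trans (lin-⊛-below -[1+ 0 ] (suc d) inv k k<d) (small k k<d))
  where
  inv = invOneMinusQ^ (suc d)
  small : ∀ k → k ℕ.< suc d → inv k ≡ one k
  small zero    _        = inv-on (suc d ∣0)
  small (suc k) sk<d     = inv-below (suc d) k sk<d
... | no k≮d = subst (λ n → (oneMinusQ^ (suc d) ⊛ inv) n ≡ one n)
                 (ℕP.m+[n∸m]≡n (ℕP.≮⇒≥ k≮d)) (large (k ∸ suc d))
  where
  inv = invOneMinusQ^ (suc d)
  large : ∀ j → (oneMinusQ^ (suc d) ⊛ inv) (suc d ℕ.+ j) ≡ + 0
  large j = begin
      (oneMinusQ^ (suc d) ⊛ inv) (suc d ℕ.+ j)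
    ≡⟨ ⊛-congʳ inv (oneMinusQ^≗lin (suc d)) (suc d ℕ.+ j) ⟩
      (lin -[1+ 0 ] (suc d) ⊛ inv) (suc d ℕ.+ j)
    ≡⟨ lin-⊛-above -[1+ 0 ] d inv j ⟩
      inv (suc d ℕ.+ j) + -[1+ 0 ] * inv j
    ≡⟨ cong₂ _+_ (inv-shift (suc d) j) (ℤP.-1*i≡-i (inv j)) ⟩
      inv j + - inv j
    ≡⟨ ℤP.+-inverseʳ (inv j) ⟩
      + 0
    ∎
    where open ≡-Reasoning

inv-trunc : ∀ {D N} → N ℕ.< D → invOneMinusQ^ D ≈[ N ] one
inv-trunc {D} N<D zero    _   = inv-on (D ∣0)
inv-trunc {D} N<D (suc k) k<N = inv-below D k (ℕP.≤-<-trans k<N N<D)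

-- The sign twist q ↦ -q

sgn : ℕ → ℤ
sgn k = -[1+ 0 ] ^ k

σ : Series → Series
σ f k = sgn k * f k

sgn-even : ∀ {k} → 2 ∣ k → sgn k ≡ + 1
sgn-even (divides q refl) = begin
    sgn (q ℕ.* 2)        ≡⟨ cong sgn (ℕP.*-comm q 2) ⟩
    sgn (2 ℕ.* q)        ≡⟨ ℤP.^-*-assoc -[1+ 0 ] 2 q ⟨
    (+ 1) ^ q            ≡⟨ ℤP.^-zeroˡ q ⟩
    + 1                  ∎
  where open ≡-Reasoning

σ-hom : ∀ f g → σ (f ⊛ g) ≗ σ f ⊛ σ g
σ-hom f g k = begin
    sgn k * (f ⊛ g) k
  ≡⟨ cong (sgn k *_) (⊛-coeff f g k) ⟩
    sgn k * sumTo (suc k) (λ i → f i * g (k ∸ i))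
  ≡⟨ sumTo-*ˡ (suc k) (sgn k) (λ i → f i * g (k ∸ i)) ⟩
    sumTo (suc k) (λ i → sgn k * (f i * g (k ∸ i)))
  ≡⟨ sumTo-cong (suc k) (λ i i≤k →
       trans (cong (_* (f i * g (k ∸ i))) (sgn-split i (ℕP.≤-pred i≤k)))
             (distribute (sgn i) (sgn (k ∸ i)) (f i) (g (k ∸ i)))) ⟩
    sumTo (suc k) (λ i → σ f i * σ g (k ∸ i))
  ≡⟨ ⊛-coeff (σ f) (σ g) k ⟨
    (σ f ⊛ σ g) k
  ∎
  where
  open ≡-Reasoning
  sgn-split : ∀ i → i ℕ.≤ k → sgn k ≡ sgn i * sgn (k ∸ i)
  sgn-split i i≤k =
    trans (cong sgn (sym (ℕP.m+[n∸m]≡n i≤k))) (ℤP.^-distribˡ-+-* -[1+ 0 ] i (k ∸ i))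
  distribute : ∀ a b x y → a * b * (x * y) ≡ a * x * (b * y)
  distribute = solve-∀

σ-one : σ one ≗ one
σ-one zero    = refl
σ-one (suc k) = ℤP.*-zeroʳ (sgn (suc k))

σ-pow : ∀ f e → σ (f ^ˢ e) ≗ σ f ^ˢ e
σ-pow f zero    = σ-one
σ-pow f (suc e) = ≗-trans (σ-hom f (f ^ˢ e)) (⊛-congˡ (σ f) (σ-pow f e))

σ-lin : ∀ a m → σ (lin a m) ≗ lin (sgn m * a) m
σ-lin a m zero = refl
σ-lin a m (suc k) with suc k ℕ.≟ m
... | yes refl = trans (cong (sgn (suc k) *_) (lin-on a k)) (sym (lin-on (sgn (suc k) * a) k))
... | no  sk≢m = trans (cong (sgn (suc k) *_) (lin-off a sk≢m))
                   (trans (ℤP.*-zeroʳ (sgn (suc k))) (sym (lin-off (sgn m * a) sk≢m)))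

σ-oneMinusQ^ : ∀ m → σ (oneMinusQ^ m) ≗ lin (sgn m * -[1+ 0 ]) m
σ-oneMinusQ^ m k = trans (cong (sgn k *_) (oneMinusQ^≗lin m k)) (σ-lin -[1+ 0 ] m k)

-- σ fixes 1/(1 - q^d) for d even, whose coefficients live in even degrees.
σ-inv : ∀ {d} → 2 ∣ d → σ (invOneMinusQ^ d) ≗ invOneMinusQ^ d
σ-inv {d} 2∣d k with d ∣? k
... | yes d∣k = cong (_* + 1) (sgn-even (∣-trans 2∣d d∣k))
... | no  _   = ℤP.*-zeroʳ (sgn k)

double : ℕ → ℕ
double zero    = zero
double (suc n) = suc (suc (double n))

double≡+ : ∀ n → double n ≡ n ℕ.+ n
double≡+ zero    = refl
double≡+ (suc n) = cong suc (trans (cong suc (double≡+ n)) (sym (ℕP.+-suc n n)))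

double≡2* : ∀ n → double n ≡ 2 ℕ.* n
double≡2* n = trans (double≡+ n) (cong (n ℕ.+_) (sym (ℕP.+-identityʳ n)))

suc-double<2*suc : ∀ K → suc (double K) ℕ.< 2 ℕ.* suc K
suc-double<2*suc K = subst (suc (double K) ℕ.<_) (double≡2* (suc K)) ℕP.≤-refl

double<2*suc : ∀ K → double K ℕ.< 2 ℕ.* suc K
double<2*suc K = ℕP.<-trans (ℕP.n<1+n (double K)) (suc-double<2*suc K)

sgn-double : ∀ n → sgn (double n) ≡ + 1
sgn-double zero    = refl
sgn-double (suc n) = cong (λ s → -[1+ 0 ] * (-[1+ 0 ] * s)) (sgn-double n)

sgn-odd : ∀ n → sgn (suc (double n)) ≡ -[1+ 0 ]
sgn-odd n = cong (-[1+ 0 ] *_) (sgn-double n)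

data Parity : ℕ → Set where
  even : ∀ K → Parity (double K)
  odd  : ∀ K → Parity (suc (double K))

parity : ∀ N → Parity N
parity zero = even zero
parity (suc N) with parity N
... | even K = odd K
... | odd  K = even (suc K)

NonNeg : Series → Set
NonNeg f = ∀ k → + 0 ≤ f k

*-nonneg : ∀ {x y} → + 0 ≤ x → + 0 ≤ y → + 0 ≤ x * y
*-nonneg {+ m} {+ n} _ _ = subst (+ 0 ≤_) (ℤP.pos-* m n) (+≤+ z≤n)

*-pos : ∀ {x y} → + 0 < x → + 0 < y → + 0 < x * y
*-pos {+ suc m} {+ suc n} _ _        = +<+ (s≤s z≤n)
*-pos {+ zero}            (+<+ ()) _
*-pos {+ suc m} {+ zero}  _        (+<+ ())

≡1⇒pos : ∀ {x} → x ≡ + 1 → + 0 < x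
≡1⇒pos refl = +<+ (s≤s z≤n)

sumTo-nonneg : ∀ n (f : ℕ → ℤ) → (∀ i → + 0 ≤ f i) → + 0 ≤ sumTo n f
sumTo-nonneg zero    f f≥0 = +≤+ z≤n
sumTo-nonneg (suc n) f f≥0 =
  ℤP.+-mono-≤ (f≥0 0) (sumTo-nonneg n (λ i → f (suc i)) (λ i → f≥0 (suc i)))

term≤sumTo : ∀ n (f : ℕ → ℤ) j → (∀ i → + 0 ≤ f i) → j ℕ.< n → f j ≤ sumTo n f
term≤sumTo (suc n) f zero f≥0 _ =
  ℤP.≤-trans (ℤP.≤-reflexive (sym (ℤP.+-identityʳ (f 0))))
    (ℤP.+-mono-≤ (ℤP.≤-refl {f 0}) (sumTo-nonneg n (λ i → f (suc i)) (λ i → f≥0 (suc i))))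
term≤sumTo (suc n) f (suc j) f≥0 (s≤s j<n) =
  ℤP.≤-trans (term≤sumTo n (λ i → f (suc i)) j (λ i → f≥0 (suc i)) j<n)
    (ℤP.≤-trans (ℤP.≤-reflexive (sym (ℤP.+-identityˡ _))) (ℤP.+-mono-≤ (f≥0 0) ℤP.≤-refl))

⊛-nonneg : ∀ {f g} → NonNeg f → NonNeg g → NonNeg (f ⊛ g)
⊛-nonneg {f} {g} f≥0 g≥0 k =
  subst (+ 0 ≤_) (sym (⊛-coeff f g k))
    (sumTo-nonneg (suc k) _ (λ i → *-nonneg (f≥0 i) (g≥0 (k ∸ i))))

⊛-pos : ∀ {f g} → NonNeg f → NonNeg g →
        ∀ a b → + 0 < f a → + 0 < g b → + 0 < (f ⊛ g) (a ℕ.+ b)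
⊛-pos {f} {g} f≥0 g≥0 a b fa>0 gb>0 = ℤP.<-≤-trans (*-pos fa>0 gb>0) term≤coeff
  where
  term≤coeff : f a * g b ≤ (f ⊛ g) (a ℕ.+ b)
  term≤coeff =
    subst₂ _≤_ (cong (λ j → f a * g j) (ℕP.m+n∸m≡n a b)) (sym (⊛-coeff f g (a ℕ.+ b)))
      (term≤sumTo (suc (a ℕ.+ b)) (λ i → f i * g (a ℕ.+ b ∸ i)) a
        (λ i → *-nonneg (f≥0 i) (g≥0 (a ℕ.+ b ∸ i))) (s≤s (ℕP.m≤m+n a b)))

one-nonneg : NonNeg one
one-nonneg zero    = +≤+ z≤n
one-nonneg (suc k) = +≤+ z≤n

pow-nonneg : ∀ {f} e → NonNeg f → NonNeg (f ^ˢ e)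
pow-nonneg zero    f≥0 = one-nonneg
pow-nonneg (suc e) f≥0 = ⊛-nonneg f≥0 (pow-nonneg e f≥0)

⊛-const : ∀ f g → f 0 ≡ + 1 → g 0 ≡ + 1 → (f ⊛ g) 0 ≡ + 1
⊛-const f g f0 g0 = cong₂ (λ a b → a * b + + 0) f0 g0

pow-const : ∀ f e → f 0 ≡ + 1 → (f ^ˢ e) 0 ≡ + 1
pow-const f zero    f0 = refl
pow-const f (suc e) f0 = ⊛-const f (f ^ˢ e) f0 (pow-const f e f0)

lin-nonneg : ∀ m → NonNeg (lin (+ 1) m)
lin-nonneg m zero    = +≤+ z≤n
lin-nonneg m (suc k) = bit-nonneg (does (suc k ℕ.≟ m))
  where
  bit-nonneg : ∀ b → + 0 ≤ (if b then + 1 else + 0)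
  bit-nonneg true  = +≤+ z≤n
  bit-nonneg false = +≤+ z≤n

lin-self-pos : ∀ m → + 0 < lin (+ 1) m m
lin-self-pos zero    = +<+ (s≤s z≤n)
lin-self-pos (suc d) = ≡1⇒pos (lin-on (+ 1) d)

lin-pow-pos : ∀ {e} → 0 ℕ.< e → ∀ m → + 0 < (lin (+ 1) m ^ˢ e) m
lin-pow-pos {suc e} _ m =
  subst (λ j → + 0 < (lin (+ 1) m ^ˢ suc e) j) (ℕP.+-identityʳ m)
    (⊛-pos (lin-nonneg m) (pow-nonneg e (lin-nonneg m)) m 0
      (lin-self-pos m) (≡1⇒pos (pow-const (lin (+ 1) m) e refl)))

lin-pow-pos-double : ∀ {e} → 1 ℕ.< e → ∀ m → + 0 < (lin (+ 1) m ^ˢ e) (m ℕ.+ m)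
lin-pow-pos-double {suc e} (s≤s e>0) m =
  ⊛-pos (lin-nonneg m) (pow-nonneg e (lin-nonneg m)) m m (lin-self-pos m) (lin-pow-pos e>0 m)

-- The product P_N and its twist, for an arbitrary exponent e.

module Twisted (e : ℕ) where

  X : ℕ → Series
  X m = oneMinusQ^ m ^ˢ e

  Y : ℕ → Series
  Y m = invOneMinusQ^ (2 ℕ.* m) ^ˢ e

  O : ℕ → Series
  O m = lin (+ 1) m ^ˢ e

  P : ℕ → Series
  P zero    = one
  P (suc N) = P N ⊛ (X (suc N) ⊛ Y (suc N))

  Odd : ℕ → Series
  Odd zero    = one
  Odd (suc K) = Odd K ⊛ O (suc (double K))

  Even : ℕ → Series
  Even zero    = one
  Even (suc K) = Even K ⊛ X (double (suc K))

  Inv : ℕ → Series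
  Inv zero    = one
  Inv (suc N) = Inv N ⊛ Y (suc N)

  σ-X-odd : ∀ {m} → sgn m ≡ -[1+ 0 ] → σ (X m) ≗ O m
  σ-X-odd {m} sgn≡-1 = ≗-trans (σ-pow (oneMinusQ^ m) e) (pow-cong e (λ k →
    trans (σ-oneMinusQ^ m k) (cong (λ s → lin (s * -[1+ 0 ]) m k) sgn≡-1)))

  σ-X-even : ∀ {m} → sgn m ≡ + 1 → σ (X m) ≗ X m
  σ-X-even {m} sgn≡1 = ≗-trans (σ-pow (oneMinusQ^ m) e) (pow-cong e (λ k →
    trans (σ-oneMinusQ^ m k)
      (trans (cong (λ s → lin (s * -[1+ 0 ]) m k) sgn≡1) (sym (oneMinusQ^≗lin m k)))))

  σ-Y : ∀ m → σ (Y m) ≗ Y m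
  σ-Y m = ≗-trans (σ-pow (invOneMinusQ^ (2 ℕ.* m)) e) (pow-cong e (σ-inv (m∣m*n m)))

  σ-factor : ∀ m {F} → σ (X m) ≗ F → σ (X m ⊛ Y m) ≗ F ⊛ Y m
  σ-factor m σX≗F = ≗-trans (σ-hom (X m) (Y m)) (⊛-cong σX≗F (σ-Y m))

  twist-even : ∀ K → σ (P (double K)) ≗ (Odd K ⊛ Even K) ⊛ Inv (double K)
  twist-odd  : ∀ K → σ (P (suc (double K))) ≗
    ((Odd K ⊛ O (suc (double K))) ⊛ Even K) ⊛ Inv (suc (double K))

  twist-even zero    = ≗-trans σ-one (≗-sym (≗-trans (⊛-identityʳ (one ⊛ one)) (⊛-identityˡ one)))
  twist-even (suc K) = begin
      σ (P (suc (double K)) ⊛ (X ev ⊛ Y ev))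
    ≈⟨ σ-hom (P (suc (double K))) (X ev ⊛ Y ev) ⟩
      σ (P (suc (double K))) ⊛ σ (X ev ⊛ Y ev)
    ≈⟨ ⊛-cong (twist-odd K) (σ-factor ev (σ-X-even (sgn-double (suc K)))) ⟩
      (((Odd K ⊛ O od) ⊛ Even K) ⊛ Inv od) ⊛ (X ev ⊛ Y ev)
    ≈⟨ regroup-even (Odd K ⊛ O od) (Even K) (Inv od) (X ev) (Y ev) ⟩
      ((Odd K ⊛ O od) ⊛ (Even K ⊛ X ev)) ⊛ (Inv od ⊛ Y ev)
    ∎
    where
    open ≗-Reasoning
    od = suc (double K)
    ev = double (suc K)

  twist-odd K = begin
      σ (P (double K) ⊛ (X od ⊛ Y od))
    ≈⟨ σ-hom (P (double K)) (X od ⊛ Y od) ⟩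
      σ (P (double K)) ⊛ σ (X od ⊛ Y od)
    ≈⟨ ⊛-cong (twist-even K) (σ-factor od (σ-X-odd (sgn-odd K))) ⟩
      ((Odd K ⊛ Even K) ⊛ Inv (double K)) ⊛ (O od ⊛ Y od)
    ≈⟨ regroup-odd (Odd K) (Even K) (Inv (double K)) (O od) (Y od) ⟩
      ((Odd K ⊛ O od) ⊛ Even K) ⊛ (Inv (double K) ⊛ Y od)
    ∎
    where
    open ≗-Reasoning
    od = suc (double K)

  X-double⊛Y : ∀ m → X (double (suc m)) ⊛ Y (suc m) ≗ one
  X-double⊛Y m =
    ≗-trans (⊛-congʳ (Y (suc m))
               (pow-cong e (λ k → cong (λ d → oneMinusQ^ d k) (double≡2* (suc m)))))
      (≗-trans (≗-sym (pow-⊛ (oneMinusQ^ (2 ℕ.* suc m)) (invOneMinusQ^ (2 ℕ.* suc m)) e))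
        (≗-trans (pow-cong e (oneMinusQ^-inverse _)) (pow-one e)))

  Even⊛Inv : ∀ K → Even K ⊛ Inv K ≗ one
  Even⊛Inv zero    = ⊛-identityˡ one
  Even⊛Inv (suc K) =
    ≗-trans (interchange (Even K) (X (double (suc K))) (Inv K) (Y (suc K)))
      (≗-trans (⊛-cong (Even⊛Inv K) (X-double⊛Y K)) (⊛-identityˡ one))

  Y-trunc : ∀ m {N} → N ℕ.< 2 ℕ.* m → Y m ≈[ N ] one
  Y-trunc m {N} N<2m = ≈-trans N (pow-congT N e (inv-trunc N<2m)) (≗⇒≈ N (pow-one e))

  Inv-trunc : ∀ K d {N} → N ℕ.< 2 ℕ.* suc K → Inv (d ℕ.+ K) ≈[ N ] Inv K
  Inv-trunc K zero    N<2K+2     = λ _ _ → refl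
  Inv-trunc K (suc d) {N} N<2K+2 =
    ≈-trans N (⊛-congT N (Inv-trunc K d N<2K+2) (Y-trunc (suc (d ℕ.+ K)) N<2m))
      (≗⇒≈ N (⊛-identityʳ (Inv K)))
    where
    N<2m : N ℕ.< 2 ℕ.* suc (d ℕ.+ K)
    N<2m = ℕP.<-≤-trans N<2K+2 (ℕP.*-monoʳ-≤ 2 (s≤s (ℕP.m≤n+m K d)))

  Even⊛Inv-trunc : ∀ K d {N} → N ℕ.< 2 ℕ.* suc K → Even K ⊛ Inv (d ℕ.+ K) ≈[ N ] one
  Even⊛Inv-trunc K d {N} N<2K+2 =
    ≈-trans N (⊛-congT {Even K} {Even K} N (λ _ _ → refl) (Inv-trunc K d N<2K+2))
      (≗⇒≈ N (Even⊛Inv K))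

  σP-coeff-even : ∀ K → σ (P (double K)) (double K) ≡ Odd K (double K)
  σP-coeff-even K =
    coeff-mod-unit {B = Odd K} {R = Even K ⊛ Inv (double K)} (double K)
      (≗-trans (twist-even K) (⊛-assoc (Odd K) (Even K) (Inv (double K))))
      (subst (λ M → Even K ⊛ Inv M ≈[ double K ] one) (sym (double≡+ K))
        (Even⊛Inv-trunc K K (double<2*suc K)))

  σP-coeff-odd : ∀ K → σ (P (suc (double K))) (suc (double K)) ≡
                       (Odd K ⊛ O (suc (double K))) (suc (double K))
  σP-coeff-odd K =
    coeff-mod-unit {B = Odd K ⊛ O (suc (double K))} {R = Even K ⊛ Inv (suc (double K))} (suc (double K))
      (≗-trans (twist-odd K) (⊛-assoc (Odd K ⊛ O (suc (double K))) (Even K) (Inv (suc (double K)))))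
      (subst (λ M → Even K ⊛ Inv M ≈[ suc (double K) ] one) (sym (cong suc (double≡+ K)))
        (Even⊛Inv-trunc K (suc K) (suc-double<2*suc K)))

  O-nonneg : ∀ m → NonNeg (O m)
  O-nonneg m = pow-nonneg e (lin-nonneg m)

  O-const : ∀ m → O m 0 ≡ + 1
  O-const m = pow-const (lin (+ 1) m) e refl

  Odd-nonneg : ∀ K → NonNeg (Odd K)
  Odd-nonneg zero    = one-nonneg
  Odd-nonneg (suc K) = ⊛-nonneg (Odd-nonneg K) (O-nonneg (suc (double K)))

  Odd-const : ∀ K → Odd K 0 ≡ + 1
  Odd-const zero    = refl
  Odd-const (suc K) = ⊛-const (Odd K) (O (suc (double K))) (Odd-const K) (O-const (suc (double K)))

  Odd-pos-one : 0 ℕ.< e → ∀ K → + 0 < Odd (suc K) 1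
  Odd-pos-one e>0 zero    = ⊛-pos one-nonneg (O-nonneg 1) 0 1 (≡1⇒pos refl) (lin-pow-pos e>0 1)
  Odd-pos-one e>0 (suc K) =
    ⊛-pos (Odd-nonneg (suc K)) (O-nonneg (suc (double (suc K)))) 1 0
      (Odd-pos-one e>0 K) (≡1⇒pos (O-const (suc (double (suc K)))))

  -- q^{2K} = q · q^{2K-1} for K ≥ 2, while for K = 1 the q² term of (1+q)^e is used.
  Odd-pos-even : 1 ℕ.< e → ∀ K → + 0 < Odd K (double K)
  Odd-pos-even e>1 zero          = ≡1⇒pos refl
  Odd-pos-even e>1 (suc zero)    =
    ⊛-pos one-nonneg (O-nonneg 1) 0 2 (≡1⇒pos refl) (lin-pow-pos-double e>1 1)
  Odd-pos-even e>1 (suc (suc K)) =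
    ⊛-pos (Odd-nonneg (suc K)) (O-nonneg (suc (double (suc K)))) 1 (suc (double (suc K)))
      (Odd-pos-one (ℕP.<⇒≤ e>1) K) (lin-pow-pos (ℕP.<⇒≤ e>1) (suc (double (suc K))))

  -- q^{2K+1} is itself an odd power.
  Odd-pos-odd : 0 ℕ.< e → ∀ K → + 0 < (Odd K ⊛ O (suc (double K))) (suc (double K))
  Odd-pos-odd e>0 K =
    ⊛-pos (Odd-nonneg K) (O-nonneg (suc (double K))) 0 (suc (double K))
      (≡1⇒pos (Odd-const K)) (lin-pow-pos e>0 (suc (double K)))

  σP-pos : 1 ℕ.< e → ∀ N → + 0 < σ (P N) N
  σP-pos e>1 N with parity N
  ... | even K = subst (+ 0 <_) (sym (σP-coeff-even K)) (Odd-pos-even e>1 K)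
  ... | odd  K = subst (+ 0 <_) (sym (σP-coeff-odd K)) (Odd-pos-odd (ℕP.<⇒≤ e>1) K)

-- The partial products of Defs are those of Twisted for the exponent 24.  (The
-- factor identity is stated for a variable m: checking it at a concrete index
-- would make the type checker unfold the 24th powers.)
factor≗XY : ∀ m → factor m ≗ Twisted.X 24 m ⊛ Twisted.Y 24 m
factor≗XY m k = refl

partialProd≗P : ∀ N → partialProd N ≗ Twisted.P 24 N
partialProd≗P zero    = ≗-refl
partialProd≗P (suc N) = ⊛-cong (partialProd≗P N) (factor≗XY (suc N))

-- c(n) = [q^{n+1}] P_{n+1}, so the theorem is σP-pos at N = n + 1.
theorem1 : (n : ℤ) → -[1+ 0 ] ≤ n → + 0 < (-[1+ 0 ] ^ ∣ n + + 1 ∣) * c n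
theorem1 n _ =
  subst (λ x → + 0 < sgn N * x) (sym (partialProd≗P N N)) (Twisted.σP-pos 24 (s≤s (s≤s z≤n)) N)
  where
  N = ∣ n + + 1 ∣
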